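{- Let $t\ge 1$. If $(4t)K_2$ admits a $1$-super graceful labeling in which all edge labels are even, then $(4t+1)K_2$ also admits a $1$-super graceful labeling in which all edge labels are even.
   Context: $nK_2$ denotes the disjoint union of $n$ copies of $K_2$. For integers $a\le b$, $[a,b]$ is the set of integers between $a$ and $b$ inclusive. For $k\ge 1$, a $k$-super graceful labeling of a graph $G=(V,E)$ with $p$ vertices and $q$ edges is a bijection $f:V\cup E\to[k,k+p+q-1]$ with $f(uv)=|f(u)-f(v)|$ for every edge $uv$. -}

module Defs where

open import Data.Nat using (ℕ; _+_; _*_; _∸_; _≤_)
open import Data.Nat.Properties using ()
open import Data.Fin using (Fin; _↑ˡ_; _↑ʳ_)
open import Data.Sum using (_⊎_; inj₁; inj₂)
open import Data.Product using (_×_; _,_; Σ; ∃)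
open import Function.Definitions using (Injective)
open import Relation.Binary.PropositionalEquality using (_≡_)
open import Data.Nat.Divisibility using (_∣_)

record Graph : Set where
  field
    p : ℕ
    q : ℕ
    ends : Fin q → Fin p × Fin p

open Graph public

absDiff : ℕ → ℕ → ℕ
absDiff a b = (a ∸ b) + (b ∸ a)

Elem : Graph → Set
Elem G = Fin (p G) ⊎ Fin (q G)

IsBijOnto : (G : Graph) → ℕ → (Elem G → ℕ) → Set
IsBijOnto G k f =
  Injective _≡_ _≡_ f
  × (∀ x → k ≤ f x × f x ≤ k + p G + q G ∸ 1)
  × (∀ m → k ≤ m → m ≤ k + p G + q G ∸ 1 → ∃ λ x → f x ≡ m)

IsSuperGraceful : (G : Graph) → ℕ → (Elem G → ℕ) → Set
IsSuperGraceful G k f =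
  IsBijOnto G k f
  × (∀ e → f (inj₂ e) ≡ absDiff (f (inj₁ (Data.Product.proj₁ (ends G e))))
                                 (f (inj₁ (Data.Product.proj₂ (ends G e)))))

nK2 : ℕ → Graph
nK2 n = record { p = n + n ; q = n ; ends = λ i → (i ↑ˡ n , n ↑ʳ i) }

HasEvenEdge1SG : Graph → Set
HasEvenEdge1SG G =
  Σ (Elem G → ℕ) λ f → IsSuperGraceful G 1 f × (∀ e → 2 ∣ f (inj₂ e))

module Submission where

-- Let f be a 1-super graceful labeling of N K₂ (N = 4t) with
-- even edge labels; it uses the labels [1, B] with B = 3N, which is even.
-- Move every odd label up by 2 and keep the even ones (liftOdd).  Since the
-- two ends of an edge have an even difference they have equal parity, so
-- all edge labels |a - b| are unchanged; the labels now fill exactly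
-- [2, B + 1].  Adding a new copy of K₂ with end labels 1 and B + 3 and edge
-- label B + 2 = |1 - (B + 3)| gives a labeling of (N + 1) K₂ onto
-- [1, B + 3] = [1, 3(N + 1)] with even edge labels.

open import Defs
open import Data.Nat using (ℕ; zero; suc; _+_; _*_; _≤_; z≤n; s≤s; parity)
open import Data.Nat.Properties
open import Data.Nat.Divisibility using (_∣_; divides)
open import Data.Nat.Tactic.RingSolver using (solve-∀)
open import Data.Parity.Base using (Parity; 0ℙ; 1ℙ; _⁻¹) renaming (_+_ to _+ℙ_)
import Data.Parity.Properties as ℙ
open import Data.Fin using (Fin; _↑ˡ_; _↑ʳ_; splitAt; join)
import Data.Fin as Fin
open import Data.Fin.Properties using (splitAt-↑ˡ; splitAt-↑ʳ; join-splitAt)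
open import Data.Sum using (_⊎_; inj₁; inj₂; [_,_]′)
open import Data.Product using (_×_; _,_; Σ; ∃; proj₁; proj₂)
open import Data.Empty using (⊥-elim)
open import Function using (_∘_)
open import Function.Bundles using (Inverse; _↔_; mk↔ₛ′)
open import Function.Definitions using (Injective)
open import Function.Construct.Symmetry using (↔-sym)
open import Relation.Binary.PropositionalEquality

parity-separates : ∀ {m n} → parity m ≡ 0ℙ → parity n ≡ 1ℙ → m ≢ n
parity-separates pm pn refl with trans (sym pm) pn
... | ()

parity-suc-even : ∀ n → parity n ≡ 0ℙ → parity (suc n) ≡ 1ℙ
parity-suc-even zero _ = refl
parity-suc-even (suc (suc n)) pn = parity-suc-even n pn

even⇒parity : ∀ {x} → 2 ∣ x → parity x ≡ 0ℙ
even⇒parity (divides q refl) = trans (ℙ.*-homo-* q 2) (ℙ.*-zeroʳ (parity q))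

parity⇒even : ∀ x → parity x ≡ 0ℙ → 2 ∣ x
parity⇒even zero _ = divides 0 refl
parity⇒even (suc (suc x)) px with parity⇒even x px
... | divides q x≡2q = divides (suc q) (cong (2 +_) x≡2q)

absDiff-even⇒sameParity : ∀ a b → parity (absDiff a b) ≡ 0ℙ → parity a ≡ parity b
absDiff-even⇒sameParity zero zero _ = refl
absDiff-even⇒sameParity zero (suc b) pd = sym pd
absDiff-even⇒sameParity (suc a) zero pd = trans (cong parity (sym (+-identityʳ (suc a)))) pd
absDiff-even⇒sameParity (suc a) (suc b) pd = ℙ.⁻¹-injective (begin
  parity (suc a) ⁻¹  ≡⟨ ℙ.suc-homo-⁻¹ a ⟩
  parity a           ≡⟨ absDiff-even⇒sameParity a b pd ⟩
  parity b           ≡⟨ ℙ.suc-homo-⁻¹ b ⟨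
  parity (suc b) ⁻¹  ∎)
  where open ≡-Reasoning

absDiff-+ˡ : ∀ c a b → absDiff (c + a) (c + b) ≡ absDiff a b
absDiff-+ˡ c a b = cong₂ _+_ ([m+n]∸[m+o]≡n∸o c a b) ([m+n]∸[m+o]≡n∸o c b a)

bump : Parity → ℕ
bump 0ℙ = 0
bump 1ℙ = 2

liftOdd : ℕ → ℕ
liftOdd x = bump (parity x) + x

liftOdd-even : ∀ {x} → parity x ≡ 0ℙ → liftOdd x ≡ x
liftOdd-even {x} px = cong (λ p → bump p + x) px

liftOdd-odd : ∀ {x} → parity x ≡ 1ℙ → liftOdd x ≡ 2 + x
liftOdd-odd {x} px = cong (λ p → bump p + x) px

liftOdd-parity : ∀ x → parity (liftOdd x) ≡ parity x
liftOdd-parity x =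
  trans (ℙ.+-homo-+ (bump (parity x)) x) (cong (_+ℙ parity x) (bump-even (parity x)))
  where
  bump-even : ∀ p → parity (bump p) ≡ 0ℙ
  bump-even 0ℙ = refl
  bump-even 1ℙ = refl

-- Equal images have equal parity, hence were shifted by the same amount.
liftOdd-injective : Injective _≡_ _≡_ liftOdd
liftOdd-injective {a} {b} la≡lb =
  +-cancelˡ-≡ (bump (parity b)) a b (trans (cong (λ p → bump p + a) (sym same)) la≡lb)
  where
  same : parity a ≡ parity b
  same = trans (sym (liftOdd-parity a)) (trans (cong parity la≡lb) (liftOdd-parity b))

-- On numbers of one parity liftOdd is a translation, so it keeps differences.
liftOdd-absDiff : ∀ a b → parity a ≡ parity b → absDiff (liftOdd a) (liftOdd b) ≡ absDiff a b
liftOdd-absDiff a b same = begin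
  absDiff (bump (parity a) + a) (bump (parity b) + b)  ≡⟨ cong (λ p → absDiff (liftOdd a) (bump p + b)) same ⟨
  absDiff (bump (parity a) + a) (bump (parity a) + b)  ≡⟨ absDiff-+ˡ (bump (parity a)) a b ⟩
  absDiff a b                                          ∎
  where open ≡-Reasoning

liftOdd-edge : ∀ a b c → c ≡ absDiff a b → parity c ≡ 0ℙ →
               liftOdd c ≡ absDiff (liftOdd a) (liftOdd b)
liftOdd-edge a b c c≡ab pc = begin
  liftOdd c                        ≡⟨ liftOdd-even pc ⟩
  c                                ≡⟨ c≡ab ⟩
  absDiff a b                      ≡⟨ liftOdd-absDiff a b sameParity ⟨
  absDiff (liftOdd a) (liftOdd b)  ∎
  where
  open ≡-Reasoning
  sameParity : parity a ≡ parity b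
  sameParity = absDiff-even⇒sameParity a b (subst (λ x → parity x ≡ 0ℙ) c≡ab pc)

liftOdd-range : ∀ {B x} → parity B ≡ 0ℙ → 1 ≤ x → x ≤ B → 2 ≤ liftOdd x × liftOdd x ≤ suc B
liftOdd-range {B} {x} pB 1≤x x≤B with parity x in px
... | 0ℙ = ≤∧≢⇒< 1≤x (≢-sym (parity-separates px refl)) , m≤n⇒m≤1+n x≤B
... | 1ℙ = s≤s (s≤s z≤n) , s≤s (≤∧≢⇒< x≤B (≢-sym (parity-separates pB px)))

liftOdd-onto : ∀ {B m} → parity B ≡ 0ℙ → 2 ≤ m → m ≤ suc B →
               ∃ λ x → (1 ≤ x × x ≤ B) × liftOdd x ≡ m
liftOdd-onto {B} {suc (suc k)} pB (s≤s (s≤s _)) m≤sB with parity k in pk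
... | 0ℙ = suc (suc k) , (s≤s z≤n , ≤-pred (≤∧≢⇒< m≤sB m≢sB)) , liftOdd-even pk
  where
  m≢sB : suc (suc k) ≢ suc B
  m≢sB = parity-separates pk (parity-suc-even B pB)
... | 1ℙ = k , (≤∧≢⇒< z≤n (parity-separates refl pk) , <⇒≤ (≤-pred m≤sB)) , liftOdd-odd pk

-- f : A → ℕ is injective and its image is exactly [lo, hi]; for A = Elem G
-- this is Defs.IsBijOnto.
BijOnto : (A : Set) → ℕ → ℕ → (A → ℕ) → Set
BijOnto A lo hi f =
  Injective _≡_ _≡_ f
  × (∀ x → lo ≤ f x × f x ≤ hi)
  × (∀ m → lo ≤ m → m ≤ hi → ∃ λ x → f x ≡ m)

bijOnto-↔ : ∀ {A B : Set} {lo hi} {g : B → ℕ} (e : A ↔ B) →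
            BijOnto B lo hi g → BijOnto A lo hi (g ∘ Inverse.to e)
bijOnto-↔ {lo = lo} {hi} {g} e (g-inj , g-range , g-onto) = inj , g-range ∘ to , onto
  where
  open Inverse e
  inj : Injective _≡_ _≡_ (g ∘ to)
  inj {x} {y} gx≡gy =
    trans (sym (strictlyInverseʳ x)) (trans (cong from (g-inj gx≡gy)) (strictlyInverseʳ y))
  onto : ∀ m → lo ≤ m → m ≤ hi → ∃ λ x → g (to x) ≡ m
  onto m lo≤m m≤hi with g-onto m lo≤m m≤hi
  ... | y , gy≡m = from y , trans (cong g (strictlyInverseˡ y)) gy≡m

data Role : Set where
  left right edge : Role

-- Labels of the new copy: ends 1 and B + 3, edge B + 2 = |1 - (B + 3)|.
newK2 : ℕ → Role → ℕ
newK2 B left  = 1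
newK2 B right = 3 + B
newK2 B edge  = 2 + B

newK2-injective : ∀ B → Injective _≡_ _≡_ (newK2 B)
newK2-injective B {left}  {left}  _ = refl
newK2-injective B {right} {right} _ = refl
newK2-injective B {edge}  {edge}  _ = refl
newK2-injective B {right} {edge}  e = ⊥-elim (1+n≰n (≤-reflexive (suc-injective (suc-injective e))))
newK2-injective B {edge}  {right} e = ⊥-elim (1+n≰n (≤-reflexive (sym (suc-injective (suc-injective e)))))
newK2-injective B {left}  {right} ()
newK2-injective B {left}  {edge}  ()
newK2-injective B {right} {left}  ()
newK2-injective B {edge}  {left}  ()

newK2-outside : ∀ {B w} → 2 ≤ w → w ≤ suc B → ∀ r → w ≢ newK2 B r
newK2-outside (s≤s ()) _ left refl
newK2-outside _ w≤sB right = <⇒≢ (s≤s (m≤n⇒m≤1+n w≤sB))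
newK2-outside _ w≤sB edge  = <⇒≢ (s≤s w≤sB)

adjoinK2 : ∀ {A : Set} → (A → ℕ) → ℕ → A ⊎ Role → ℕ
adjoinK2 f B = [ liftOdd ∘ f , newK2 B ]′

split-[1,B+3] : ∀ {B m} → 1 ≤ m → m ≤ 3 + B →
                m ≡ 1 ⊎ (2 ≤ m × m ≤ suc B) ⊎ m ≡ 2 + B ⊎ m ≡ 3 + B
split-[1,B+3] 1≤m m≤ with m≤n⇒m<n∨m≡n m≤
... | inj₂ m≡ = inj₂ (inj₂ (inj₂ m≡))
... | inj₁ (s≤s m≤2+B) with m≤n⇒m<n∨m≡n m≤2+B
...   | inj₂ m≡ = inj₂ (inj₂ (inj₁ m≡))
...   | inj₁ (s≤s m≤sB) with m≤n⇒m<n∨m≡n 1≤m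
...     | inj₂ 1≡m = inj₁ (sym 1≡m)
...     | inj₁ 2≤m = inj₂ (inj₁ (2≤m , m≤sB))

-- Main counting step: if f hits [1, B] exactly once each and B is even, the
-- lifted labels fill [2, B + 1] and the new copy adds 1, B + 2 and B + 3.
adjoinK2-bijOnto : ∀ {A : Set} {B} {f : A → ℕ} → parity B ≡ 0ℙ →
                   BijOnto A 1 B f → BijOnto (A ⊎ Role) 1 (3 + B) (adjoinK2 f B)
adjoinK2-bijOnto {A} {B} {f} pB (f-inj , f-range , f-onto) = inj , range , onto
  where
  lifted-range : ∀ x → 2 ≤ liftOdd (f x) × liftOdd (f x) ≤ suc B
  lifted-range x = liftOdd-range pB (proj₁ (f-range x)) (proj₂ (f-range x))

  lifted≢new : ∀ x r → liftOdd (f x) ≢ newK2 B r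
  lifted≢new x r = newK2-outside (proj₁ (lifted-range x)) (proj₂ (lifted-range x)) r

  inj : Injective _≡_ _≡_ (adjoinK2 f B)
  inj {inj₁ x} {inj₁ y} e = cong inj₁ (f-inj (liftOdd-injective e))
  inj {inj₁ x} {inj₂ r} e = ⊥-elim (lifted≢new x r e)
  inj {inj₂ r} {inj₁ y} e = ⊥-elim (lifted≢new y r (sym e))
  inj {inj₂ r} {inj₂ s} e = cong inj₂ (newK2-injective B e)

  range : ∀ z → 1 ≤ adjoinK2 f B z × adjoinK2 f B z ≤ 3 + B
  range (inj₁ x) = let 2≤l , l≤sB = lifted-range x in
                   <⇒≤ 2≤l , ≤-trans l≤sB (m≤n+m (suc B) 2)
  range (inj₂ left)  = s≤s z≤n , s≤s z≤n
  range (inj₂ right) = s≤s z≤n , ≤-refl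
  range (inj₂ edge)  = s≤s z≤n , n≤1+n (2 + B)

  onto : ∀ m → 1 ≤ m → m ≤ 3 + B → ∃ λ z → adjoinK2 f B z ≡ m
  onto m 1≤m m≤ with split-[1,B+3] 1≤m m≤
  ... | inj₁ refl = inj₂ left , refl
  ... | inj₂ (inj₂ (inj₁ refl)) = inj₂ edge , refl
  ... | inj₂ (inj₂ (inj₂ refl)) = inj₂ right , refl
  ... | inj₂ (inj₁ (2≤m , m≤sB)) with liftOdd-onto pB 2≤m m≤sB
  ...   | x , (1≤x , x≤B) , lx≡m with f-onto x 1≤x x≤B
  ...     | y , fy≡x = inj₁ y , trans (cong liftOdd fy≡x) lx≡m

-- An element of N K₂ is a pair (copy, role): edge i joins i ↑ˡ N and N ↑ʳ i.
endRole : ∀ {N} → Fin N ⊎ Fin N → Fin N × Role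
endRole (inj₁ i) = i , left
endRole (inj₂ i) = i , right

toRoles : ∀ N → Elem (nK2 N) → Fin N × Role
toRoles N (inj₁ v) = endRole (splitAt N v)
toRoles N (inj₂ e) = e , edge

fromRoles : ∀ N → Fin N × Role → Elem (nK2 N)
fromRoles N (i , left)  = inj₁ (i ↑ˡ N)
fromRoles N (i , right) = inj₁ (N ↑ʳ i)
fromRoles N (i , edge)  = inj₂ i

roles : ∀ N → Elem (nK2 N) ↔ (Fin N × Role)
roles N = mk↔ₛ′ (toRoles N) (fromRoles N) to∘from from∘to
  where
  to∘from : ∀ x → toRoles N (fromRoles N x) ≡ x
  to∘from (i , left)  = cong endRole (splitAt-↑ˡ N i N)
  to∘from (i , right) = cong endRole (splitAt-↑ʳ N N i)
  to∘from (i , edge)  = refl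
  from-endRole : ∀ s → fromRoles N (endRole s) ≡ inj₁ (join N N s)
  from-endRole (inj₁ i) = refl
  from-endRole (inj₂ i) = refl
  from∘to : ∀ x → fromRoles N (toRoles N x) ≡ x
  from∘to (inj₁ v) = trans (from-endRole (splitAt N v)) (cong inj₁ (join-splitAt N N v))
  from∘to (inj₂ e) = refl

-- A labeling of N K₂ by (copy, role) that is 1-super graceful with even
-- edge labels; 3N = (N + N) + N is the number of vertices and edges.
EvenGraceful : (N : ℕ) → (Fin N × Role → ℕ) → Set
EvenGraceful N L =
  BijOnto (Fin N × Role) 1 ((N + N) + N) L
  × (∀ i → L (i , edge) ≡ absDiff (L (i , left)) (L (i , right)))
  × (∀ i → 2 ∣ L (i , edge))

-- Labelings of N K₂ and role labelings correspond; the edge condition of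
-- Defs is literally the per-copy condition of EvenGraceful.
toRoleLabeling : ∀ N → HasEvenEdge1SG (nK2 N) → Σ (Fin N × Role → ℕ) (EvenGraceful N)
toRoleLabeling N (f , (f-bij , f-edges) , f-even) =
  f ∘ fromRoles N , bijOnto-↔ (↔-sym (roles N)) f-bij , f-edges , f-even

fromRoleLabeling : ∀ N L → EvenGraceful N L → HasEvenEdge1SG (nK2 N)
fromRoleLabeling N L (L-bij , L-edges , L-even) =
  L ∘ toRoles N , (bijOnto-↔ (roles N) L-bij , edges) , L-even
  where
  edges : ∀ e → L (toRoles N (inj₂ e)) ≡
                absDiff (L (toRoles N (inj₁ (e ↑ˡ N)))) (L (toRoles N (inj₁ (N ↑ʳ e))))
  edges e rewrite splitAt-↑ˡ N e N | splitAt-↑ʳ N N e = L-edges e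

lastCopy : ∀ {N} → Fin N ⊎ Fin 1 → Role → (Fin N × Role) ⊎ Role
lastCopy (inj₁ j) r = inj₁ (j , r)
lastCopy (inj₂ _) r = inj₂ r

splitLast : ∀ N → (Fin (N + 1) × Role) ↔ ((Fin N × Role) ⊎ Role)
splitLast N = mk↔ₛ′ to from to∘from from∘to
  where
  to : Fin (N + 1) × Role → (Fin N × Role) ⊎ Role
  to (i , r) = lastCopy (splitAt N i) r
  from : (Fin N × Role) ⊎ Role → Fin (N + 1) × Role
  from (inj₁ (j , r)) = j ↑ˡ 1 , r
  from (inj₂ r)       = N ↑ʳ Fin.zero , r
  to∘from : ∀ z → to (from z) ≡ z
  to∘from (inj₁ (j , r)) = cong (λ s → lastCopy s r) (splitAt-↑ˡ N j 1)
  to∘from (inj₂ r)       = cong (λ s → lastCopy s r) (splitAt-↑ʳ N 1 Fin.zero)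
  from-lastCopy : ∀ s r → from (lastCopy s r) ≡ (join N 1 s , r)
  from-lastCopy (inj₁ j)        r = refl
  from-lastCopy (inj₂ Fin.zero) r = refl
  from∘to : ∀ x → from (to x) ≡ x
  from∘to (i , r) = trans (from-lastCopy (splitAt N i) r) (cong (_, r) (join-splitAt N 1 i))

extendLabeling : ∀ N → (Fin N × Role → ℕ) → Fin (N + 1) × Role → ℕ
extendLabeling N L = adjoinK2 L ((N + N) + N) ∘ Inverse.to (splitLast N)

threefold-bound : ∀ N → ((N + 1) + (N + 1)) + (N + 1) ≡ 3 + ((N + N) + N)
threefold-bound = solve-∀

threefold-even : ∀ N → parity N ≡ 0ℙ → parity ((N + N) + N) ≡ 0ℙ
threefold-even N pN =
  trans (ℙ.+-homo-+ (N + N) N) (cong₂ _+ℙ_ (trans (ℙ.+-homo-+ N N) (cong₂ _+ℙ_ pN pN)) pN)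

extend-evenGraceful : ∀ N {L} → parity N ≡ 0ℙ → EvenGraceful N L →
                      EvenGraceful (N + 1) (extendLabeling N L)
extend-evenGraceful N {L} pN (L-bij , L-edges , L-even) =
  bij , (λ i → edges (splitAt N i)) , (λ i → even (splitAt N i))
  where
  B : ℕ
  B = (N + N) + N
  pB : parity B ≡ 0ℙ
  pB = threefold-even N pN
  M : (Fin N × Role) ⊎ Role → ℕ
  M = adjoinK2 L B

  bij : BijOnto (Fin (N + 1) × Role) 1 (((N + 1) + (N + 1)) + (N + 1)) (extendLabeling N L)
  bij = subst (λ hi → BijOnto _ 1 hi (extendLabeling N L)) (sym (threefold-bound N))
              (bijOnto-↔ (splitLast N) (adjoinK2-bijOnto pB L-bij))

  edges : ∀ s → M (lastCopy s edge) ≡ absDiff (M (lastCopy s left)) (M (lastCopy s right))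
  edges (inj₁ j) = liftOdd-edge (L (j , left)) (L (j , right)) (L (j , edge))
                                (L-edges j) (even⇒parity (L-even j))
  edges (inj₂ _) = refl

  even : ∀ s → 2 ∣ M (lastCopy s edge)
  even (inj₁ j) = subst (2 ∣_) (sym (liftOdd-even (even⇒parity (L-even j)))) (L-even j)
  even (inj₂ _) = parity⇒even (2 + B) pB

-- Theorem 3.2.
theorem3p2 : (t : ℕ) → 1 ≤ t → HasEvenEdge1SG (nK2 (4 * t)) → HasEvenEdge1SG (nK2 (4 * t + 1))
theorem3p2 t _ h =
  let L , L-graceful = toRoleLabeling (4 * t) h
      4t-even = ℙ.*-homo-* 4 t
  in fromRoleLabeling (4 * t + 1) (extendLabeling (4 * t) L)
                      (extend-evenGraceful (4 * t) 4t-even L-graceful)
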